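{- Given an odd integer $b\geqslant 5$, there exists a signed magic array set $\mathrm{SMAS}(6,b;c)$ for all $c\geqslant 1$.
   Context: For positive integers $a,b,e$, a signed magic array set $\mathrm{SMAS}(a,b;e)$ is a set of $e$ (completely filled) arrays of size $a\times b$ with entries in $\Omega\subset\mathbb{Z}$, where $\Omega=\{0,\pm1,\pm2,\ldots,\pm(abe-1)/2\}$ if $abe$ is odd and $\Omega=\{\pm1,\pm2,\ldots,\pm abe/2\}$ if $abe$ is even, such that (a) every $\omega\in\Omega$ appears exactly once and in a unique array; (b) for every array, the sum of the elements in each row and in each column is $0$. -}

module Defs where

open import Data.Nat as ℕ using (ℕ; _*_)
open import Data.Nat.DivMod using (_/_; _%_)
open import Data.Integer as ℤ using (ℤ; ∣_∣; +_)
open import Data.Fin using (Fin; zero; suc)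
open import Data.Fin.Properties using ()
open import Data.Product using (Σ; ∃; _×_; _,_)
open import Data.Empty using (⊥)
open import Relation.Binary.PropositionalEquality using (_≡_; _≢_)
open import Relation.Nullary using (¬_)

Σℤ : (n : ℕ) → (Fin n → ℤ) → ℤ
Σℤ ℕ.zero    f = + 0
Σℤ (ℕ.suc n) f = f zero ℤ.+ Σℤ n (λ i → f (suc i))

-- Membership in Ω for total size N = a*b*e:
--   N odd : Ω = {0, ±1, ..., ±(N-1)/2}
--   N even: Ω = {±1, ..., ±N/2}
InΩ : ℕ → ℤ → Set
InΩ N x with N % 2
... | 0 = (x ≢ + 0) × (∣ x ∣ ℕ.≤ N / 2)
... | _ = ∣ x ∣ ℕ.≤ N / 2

-- A set of e arrays of size a×b: array k has entry A k i j in row i, column j.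
Arrays : ℕ → ℕ → ℕ → Set
Arrays a b e = Fin e → Fin a → Fin b → ℤ

record IsSMAS (a b e : ℕ) (A : Arrays a b e) : Set where
  field
    entries-in-Ω : ∀ k i j → InΩ (a * b * e) (A k i j)
    entries-distinct : ∀ k i j k′ i′ j′ → A k i j ≡ A k′ i′ j′ →
                       (k ≡ k′) × (i ≡ i′) × (j ≡ j′)
    Ω-covered : ∀ ω → InΩ (a * b * e) ω → ∃ λ k → ∃ λ i → ∃ λ j → A k i j ≡ ω
    row-sums : ∀ k i → Σℤ b (λ j → A k i j) ≡ + 0
    col-sums : ∀ k j → Σℤ a (λ i → A k i j) ≡ + 0

SMAS : ℕ → ℕ → ℕ → Set
SMAS a b e = Σ (Arrays a b e) (IsSMAS a b e)

module Submission where

-- The values ±1, …, ±3bc are cut into 2m blocks of c consecutive values, m = 3b of each sign.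
-- A core is a 6 × w pattern whose cells carry a sign and either one block, run up or down
-- through the c arrays, or one parity half of two adjacent blocks. Array k then has entries
-- affine in c and k, so its line sums vanish for all c and k as soon as their coefficients do,
-- and reading the pattern backwards shows that the arrays use each value exactly once. Cores
-- of widths 5 and 7 are checked by evaluation. A 6 × 4 core with as many + as − cells in every
-- line can be appended any number of times with its blocks shifted, since a shift changes each
-- line sum by a multiple of that signed count; every odd b ≥ 5 is 5 or 7 plus a multiple of 4.

open import Defs
open import Data.Nat using (ℕ; _≤_; _%_)
open import Relation.Binary.PropositionalEquality using (_≡_)

open import Data.Bool using (Bool; true; false)
open import Data.Fin as Fin using (Fin; zero; suc; #_; toℕ; _↑ˡ_; _↑ʳ_; splitAt; join; combine; remQuot; cast; opposite)
import Data.Fin.Properties as Fin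
open import Data.Integer using (ℤ; +_; -[1+_]; _+_; _*_; -_; _-_; _⊖_; ∣_∣)
import Data.Integer.Properties as ℤ
open import Data.Integer.Tactic.RingSolver using (solve-∀)
import Data.Nat.Tactic.RingSolver as NatSolver
open import Data.Nat as ℕ using (suc; _<_; _/_; s≤s)
open import Data.Nat.DivMod using (m*n/n≡m; m*n%n≡0)
import Data.Nat.Properties as ℕ
open import Data.Product.Properties using (≡-dec)
open import Data.Product using (∃;Σ; _×_; _,_; proj₁; proj₂; map₁; map₂; uncurry)
open import Data.Unit using (⊤)
open import Data.Empty using (⊥-elim)
open import Data.Vec using (Vec; []; _∷_; lookup)
open import Data.Sum as Sum using (_⊎_; inj₁; inj₂)
open import Function using (_∘_; _↔_; Inverse; Injection)
open import Function.Definitions using (Injective)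
open import Function.Properties.Inverse using (↔-refl; ↔-sym; ↔-trans; ↔⇒↣)
open import Data.Product.Function.NonDependent.Propositional using (_×-↔_)
open import Relation.Binary.Definitions using (DecidableEquality)
open import Relation.Nullary.Decidable using (Dec; yes; no; _×-dec_; map′; from-yes)
open import Relation.Binary.PropositionalEquality using (_≢_; subst; refl; sym; trans; cong; cong₂; module ≡-Reasoning)

Σℤ-cong : ∀ n {f g : Fin n → ℤ} → (∀ i → f i ≡ g i) → Σℤ n f ≡ Σℤ n g
Σℤ-cong ℕ.zero    f≗g = refl
Σℤ-cong (suc n) f≗g = cong₂ _+_ (f≗g zero) (Σℤ-cong n (f≗g ∘ suc))

Σℤ-splitAt : ∀ m n (g : Fin m ⊎ Fin n → ℤ) →
             Σℤ (m ℕ.+ n) (g ∘ splitAt m) ≡ Σℤ m (g ∘ inj₁) + Σℤ n (g ∘ inj₂)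
Σℤ-splitAt ℕ.zero    n g = sym (ℤ.+-identityˡ _)
Σℤ-splitAt (suc m) n g =
  trans (cong (_+_ (g (inj₁ zero))) (Σℤ-splitAt m n (g ∘ Sum.map₁ suc))) (sym (ℤ.+-assoc (g (inj₁ zero)) _ _))

Σℤ-+ : ∀ n (f g : Fin n → ℤ) → Σℤ n (λ i → f i + g i) ≡ Σℤ n f + Σℤ n g
Σℤ-+ ℕ.zero    f g = refl
Σℤ-+ (suc n) f g = trans (cong (_+_ (f zero + g zero)) (Σℤ-+ n (f ∘ suc) (g ∘ suc)))
                          (interchange (f zero) (g zero) _ _)
  where
  interchange : ∀ a b x y → a + b + (x + y) ≡ a + x + (b + y)
  interchange = solve-∀

Σℤ-*ˡ : ∀ n t (f : Fin n → ℤ) → Σℤ n (λ i → t * f i) ≡ t * Σℤ n f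
Σℤ-*ˡ ℕ.zero    t f = sym (ℤ.*-zeroʳ t)
Σℤ-*ˡ (suc n) t f = trans (cong (_+_ (t * f zero)) (Σℤ-*ˡ n t (f ∘ suc)))
                           (sym (ℤ.*-distribˡ-+ t (f zero) _))

signed : Bool → ℤ → ℤ
signed true  x = x
signed false x = - x

signed-+ : ∀ σ x y → signed σ (x + y) ≡ signed σ x + signed σ y
signed-+ true  x y = refl
signed-+ false x y = ℤ.neg-distrib-+ x y

signed-scale : ∀ σ t → signed σ t ≡ t * signed σ (+ 1)
signed-scale true  t = sym (ℤ.*-identityʳ t)
signed-scale false t = neg≡*-1 t
  where
  neg≡*-1 : ∀ t → - t ≡ t * - + 1
  neg≡*-1 = solve-∀

injective⇒surjective : ∀ {n} (f : Fin n → Fin n) → Injective _≡_ _≡_ f → ∀ y → ∃ λ x → f x ≡ y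
injective⇒surjective {suc n} f f-injective y with Fin.any? (λ x → f x Fin.≟ y)
... | yes hit  = hit
... | no  miss = ⊥-elim (ℕ.n≮n n (Fin.injective⇒≤ punched-injective))
  where
  y≢f : ∀ x → y ≢ f x
  y≢f x y≡fx = miss (x , sym y≡fx)
  punched : Fin (suc n) → Fin n
  punched x = Fin.punchOut (y≢f x)
  punched-injective : Injective _≡_ _≡_ punched
  punched-injective {x} {x′} eq = f-injective (Fin.punchOut-injective (y≢f x) (y≢f x′) eq)

↔-injective⇒surjective : ∀ {A B : Set} {n} → A ↔ Fin n → B ↔ Fin n →
                         (f : A → B) → Injective _≡_ _≡_ f → ∀ y → ∃ λ x → f x ≡ y
↔-injective⇒surjective A↔ B↔ f f-injective y =
  let x , gx≡y = injective⇒surjective g g-injective (B.to y) in A.from x , to-injective B↔ gx≡y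
  where
  module A = Inverse A↔
  module B = Inverse B↔
  to-injective : ∀ {C D : Set} (C↔D : C ↔ D) → Injective _≡_ _≡_ (Inverse.to C↔D)
  to-injective C↔D = Injection.injective (↔⇒↣ C↔D)
  g : Fin _ → Fin _
  g = B.to ∘ f ∘ A.from
  g-injective : Injective _≡_ _≡_ g
  g-injective eq = to-injective (↔-sym A↔) (f-injective (to-injective B↔ eq))

entry : ∀ {m c} → Bool × Fin m × Fin c → ℤ
entry (σ , q , r) = signed σ (+ suc (toℕ (combine q r)))

signed-suc-injective : ∀ σ σ′ n n′ → signed σ (+ suc n) ≡ signed σ′ (+ suc n′) → σ ≡ σ′ × n ≡ n′
signed-suc-injective true  true  n .n refl = refl , refl
signed-suc-injective false false n .n refl = refl , refl
signed-suc-injective true  false n n′ ()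
signed-suc-injective false true  n n′ ()

entry-injective : ∀ {m c} → Injective _≡_ _≡_ (entry {m} {c})
entry-injective {x = σ , q , r} {σ′ , q′ , r′} eq
  with refl , n≡n′ ← signed-suc-injective σ σ′ _ _ eq
  with refl , refl ← Fin.combine-injective q r q′ r′ (Fin.toℕ-injective n≡n′)
  = refl

entry-nonzero : ∀ {m c} (y : Bool × Fin m × Fin c) → entry y ≢ + 0
entry-nonzero (true  , _) ()
entry-nonzero (false , _) ()

∣entry∣≤ : ∀ {m c} (y : Bool × Fin m × Fin c) → ∣ entry y ∣ ≤ m ℕ.* c
∣entry∣≤ (true  , q , r) = Fin.toℕ<n (combine q r)
∣entry∣≤ (false , q , r) = Fin.toℕ<n (combine q r)

blockOffset : ∀ m c {n} → n < m ℕ.* c → Fin m × Fin c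
blockOffset m c n<mc = remQuot {m} c (Fin.fromℕ< n<mc)

toℕ-blockOffset : ∀ m c {n} (n<mc : n < m ℕ.* c) → toℕ (uncurry combine (blockOffset m c n<mc)) ≡ n
toℕ-blockOffset m c n<mc = trans (cong toℕ (Fin.combine-remQuot {m} c _)) (Fin.toℕ-fromℕ< n<mc)

entry-onto : ∀ {m c} x → x ≢ + 0 → ∣ x ∣ ≤ m ℕ.* c → ∃ λ y → entry {m} {c} y ≡ x
entry-onto         (+ ℕ.zero) x≢0 _  = ⊥-elim (x≢0 refl)
entry-onto {m} {c} (+ suc n)  _ n<mc =
  (true , blockOffset m c n<mc) , cong (+_ ∘ suc) (toℕ-blockOffset m c n<mc)
entry-onto {m} {c} -[1+ n ]   _ n<mc =
  (false , blockOffset m c n<mc) , cong (-_ ∘ +_ ∘ suc) (toℕ-blockOffset m c n<mc)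

InΩ-intro : ∀ N x → x ≢ + 0 → ∣ x ∣ ≤ N / 2 → InΩ N x
InΩ-intro N x x≢0 x≤ with N % 2
... | ℕ.zero = x≢0 , x≤
... | suc _  = x≤

InΩ-even-elim : ∀ N x → N % 2 ≡ 0 → InΩ N x → x ≢ + 0 × ∣ x ∣ ≤ N / 2
InΩ-even-elim N x N-even x∈Ω with N % 2
InΩ-even-elim N x refl x∈Ω | .0 = x∈Ω

-- α + β c + γ r, as a function of the block length c and the array index r.
Affine : Set
Affine = ℤ × ℤ × ℤ

⟦_⟧ : Affine → ℤ → ℤ → ℤ
⟦ α , β , γ ⟧ c r = α + β * c + γ * r

0ᵃ : Affine
0ᵃ = + 0 , + 0 , + 0

_+ᵃ_ : Affine → Affine → Affine
(α , β , γ) +ᵃ (α′ , β′ , γ′) = α + α′ , β + β′ , γ + γ′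

Σᵃ : ∀ n → (Fin n → Affine) → Affine
Σᵃ ℕ.zero  f = 0ᵃ
Σᵃ (suc n) f = f zero +ᵃ Σᵃ n (f ∘ suc)

⟦0ᵃ⟧ : ∀ c r → ⟦ 0ᵃ ⟧ c r ≡ + 0
⟦0ᵃ⟧ = lemma
  where
  lemma : ∀ c r → + 0 + + 0 * c + + 0 * r ≡ + 0
  lemma = solve-∀

⟦+ᵃ⟧ : ∀ a b c r → ⟦ a +ᵃ b ⟧ c r ≡ ⟦ a ⟧ c r + ⟦ b ⟧ c r
⟦+ᵃ⟧ (α , β , γ) (α′ , β′ , γ′) = lemma α β γ α′ β′ γ′
  where
  lemma : ∀ α β γ α′ β′ γ′ c r →
          α + α′ + (β + β′) * c + (γ + γ′) * r ≡ α + β * c + γ * r + (α′ + β′ * c + γ′ * r)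
  lemma = solve-∀

⟦Σᵃ⟧ : ∀ n (f : Fin n → Affine) c r → ⟦ Σᵃ n f ⟧ c r ≡ Σℤ n (λ i → ⟦ f i ⟧ c r)
⟦Σᵃ⟧ ℕ.zero  f c r = ⟦0ᵃ⟧ c r
⟦Σᵃ⟧ (suc n) f c r = trans (⟦+ᵃ⟧ (f zero) _ c r) (cong (_+_ (⟦ f zero ⟧ c r)) (⟦Σᵃ⟧ n (f ∘ suc) c r))

signedᵃ : Bool → Affine → Affine
signedᵃ σ (α , β , γ) = signed σ α , signed σ β , signed σ γ

⟦signedᵃ⟧ : ∀ σ a c r → ⟦ signedᵃ σ a ⟧ c r ≡ signed σ (⟦ a ⟧ c r)
⟦signedᵃ⟧ true  a         c r = refl
⟦signedᵃ⟧ false (α , β , γ) c r = lemma α β γ c r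
  where
  lemma : ∀ α β γ c r → - α + - β * c + - γ * r ≡ - (α + β * c + γ * r)
  lemma = solve-∀

data Kind (m : ℕ) : Set where
  up down : Fin m → Kind m
  pair    : (L U : Fin m) → Fin 2 → Kind m

Cell : ℕ → Set
Cell m = Bool × Kind m

⁺_ ⁻_ : ∀ {m} → Kind m → Cell m
⁺ κ = true , κ
⁻ κ = false , κ

-- Filling a cell of kind κ in array r (of c) from the values 1 + q c, …, (q + 1) c of block q:
-- up q puts 1 + q c + r, down q puts (q + 1) c − r, and pair L U h (with U = L + 1) puts
-- 1 + L c + 2 r + h, so that the two cells pair L U 0 and pair L U 1 share the blocks L and U.
coefficients : ∀ {m} → Kind m → Affine
coefficients (up q)       = + 1 , + toℕ q , + 1
coefficients (down q)     = + 0 , + suc (toℕ q) , - + 1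
coefficients (pair L _ h) = + suc (toℕ h) , + toℕ L , + 2

value : ∀ {m} → Kind m → ℤ → ℤ → ℤ
value = ⟦_⟧ ∘ coefficients

cellValue : ∀ {m} → Cell m → ℤ → ℤ → ℤ
cellValue (σ , κ) c r = signed σ (value κ c r)

Adjacent : ∀ {m} → Kind m → Set
Adjacent (pair L U _) = toℕ U ≡ suc (toℕ L)
Adjacent _            = ⊤

pick : {A : Set} → Fin 2 → A → A → A
pick zero    x y = x
pick (suc _) x y = y

-- Copy k of half h of a pair is the entry 2 k + h = c e + r of the pair, i.e. offset r of its block e.
interleave : ∀ {c} → Fin c → Fin 2 → Fin 2 × Fin c
interleave {c} k h = remQuot c (cast (ℕ.*-comm c 2) (combine k h))

deinterleave : ∀ {c} → Fin 2 → Fin c → Fin c × Fin 2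
deinterleave {c} e r = remQuot 2 (cast (ℕ.*-comm 2 c) (combine e r))

deinterleave-interleave : ∀ {c} (k : Fin c) h → uncurry deinterleave (interleave k h) ≡ (k , h)
deinterleave-interleave {c} k h = begin
  remQuot {c} 2 (cast 2c≡c2 (uncurry combine (remQuot {2} c (cast c2≡2c (combine k h)))))
    ≡⟨ cong (remQuot {c} 2 ∘ cast 2c≡c2) (Fin.combine-remQuot {2} c _) ⟩
  remQuot {c} 2 (cast 2c≡c2 (cast c2≡2c (combine k h)))
    ≡⟨ cong (remQuot {c} 2) (Fin.cast-involutive 2c≡c2 c2≡2c _) ⟩
  remQuot {c} 2 (combine k h)
    ≡⟨ Fin.remQuot-combine k h ⟩
  (k , h) ∎
  where
  open ≡-Reasoning
  c2≡2c : c ℕ.* 2 ≡ 2 ℕ.* c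
  c2≡2c = ℕ.*-comm c 2
  2c≡c2 : 2 ℕ.* c ≡ c ℕ.* 2
  2c≡c2 = ℕ.*-comm 2 c

toℕ-interleave : ∀ {c} (k : Fin c) h → toℕ (uncurry combine (interleave k h)) ≡ 2 ℕ.* toℕ k ℕ.+ toℕ h
toℕ-interleave {c} k h = begin
  toℕ (uncurry combine (remQuot {2} c (cast _ (combine k h)))) ≡⟨ cong toℕ (Fin.combine-remQuot {2} c _) ⟩
  toℕ (cast _ (combine k h))                                   ≡⟨ Fin.toℕ-cast _ (combine k h) ⟩
  toℕ (combine k h)                                            ≡⟨ Fin.toℕ-combine k h ⟩
  2 ℕ.* toℕ k ℕ.+ toℕ h                                        ∎
  where open ≡-Reasoning

place : ∀ {m c} → Kind m → Fin c → Fin m × Fin c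
place (up q)       k = q , k
place (down q)     k = q , opposite k
place (pair L U h) k = map₁ (λ e → pick e L U) (interleave k h)

index : ∀ {m c} → Kind m → Fin c → ℕ
index κ k = toℕ (uncurry combine (place κ k))

+suc-block : ∀ c q t → + suc (c ℕ.* q ℕ.+ t) ≡ + 1 + + q * + c + + t
+suc-block c q t = trans (cong (λ x → + 1 + (x + + t)) (ℤ.pos-* c q)) (reorder (+ c) (+ q) (+ t))
  where
  reorder : ∀ c q t → + 1 + (c * q + t) ≡ + 1 + q * c + t
  reorder = solve-∀

index-pick : ∀ {m c} {L U : Fin m} h → Adjacent (pair L U h) → ∀ e (r : Fin c) →
             toℕ (combine (pick e L U) r) ≡ c ℕ.* toℕ L ℕ.+ toℕ (combine e r)
index-pick {c = c} {L} h adj zero r = begin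
  toℕ (combine L r)     ≡⟨ Fin.toℕ-combine L r ⟩
  c ℕ.* toℕ L ℕ.+ toℕ r ≡⟨ cong (c ℕ.* toℕ L ℕ.+_) (sym (Fin.toℕ-↑ˡ r _)) ⟩
  c ℕ.* toℕ L ℕ.+ toℕ (combine {2} zero r) ∎
  where open ≡-Reasoning
index-pick {c = c} {L} {U} h adj (suc zero) r = begin
  toℕ (combine U r)              ≡⟨ Fin.toℕ-combine U r ⟩
  c ℕ.* toℕ U ℕ.+ toℕ r          ≡⟨ cong (λ x → c ℕ.* x ℕ.+ toℕ r) adj ⟩
  c ℕ.* suc (toℕ L) ℕ.+ toℕ r    ≡⟨ lemma c (toℕ L) (toℕ r) ⟩
  c ℕ.* toℕ L ℕ.+ (c ℕ.* 1 ℕ.+ toℕ r)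
    ≡⟨ cong (c ℕ.* toℕ L ℕ.+_) (sym (Fin.toℕ-combine {2} (suc zero) r)) ⟩
  c ℕ.* toℕ L ℕ.+ toℕ (combine {2} (suc zero) r) ∎
  where
  open ≡-Reasoning
  lemma : ∀ c l x → c ℕ.* suc l ℕ.+ x ≡ c ℕ.* l ℕ.+ (c ℕ.* 1 ℕ.+ x)
  lemma = NatSolver.solve-∀

+opposite : ∀ {c} (k : Fin c) → + toℕ (opposite k) ≡ + c - + suc (toℕ k)
+opposite {c} k = begin
  + toℕ (opposite k)  ≡⟨ cong +_ (Fin.opposite-prop k) ⟩
  + (c ℕ.∸ suc (toℕ k)) ≡⟨ sym (ℤ.⊖-≥ (Fin.toℕ<n k)) ⟩
  c ⊖ suc (toℕ k)       ≡⟨ sym (ℤ.m-n≡m⊖n c (suc (toℕ k))) ⟩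
  + c - + suc (toℕ k)   ∎
  where open ≡-Reasoning

place-value : ∀ {m c} (κ : Kind m) → Adjacent κ → (k : Fin c) → + suc (index κ k) ≡ value κ (+ c) (+ toℕ k)
place-value {c = c} (up q) _ k = begin
  + suc (toℕ (combine q k))             ≡⟨ cong (+_ ∘ suc) (Fin.toℕ-combine q k) ⟩
  + suc (c ℕ.* toℕ q ℕ.+ toℕ k)         ≡⟨ +suc-block c (toℕ q) (toℕ k) ⟩
  + 1 + + toℕ q * + c + + toℕ k         ≡⟨ cong (_+_ (+ 1 + + toℕ q * + c)) (sym (ℤ.*-identityˡ (+ toℕ k))) ⟩
  value (up q) (+ c) (+ toℕ k)          ∎
  where open ≡-Reasoning
place-value {c = c} (down q) _ k = begin
  + suc (toℕ (combine q (opposite k)))         ≡⟨ cong (+_ ∘ suc) (Fin.toℕ-combine q (opposite k)) ⟩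
  + suc (c ℕ.* toℕ q ℕ.+ toℕ (opposite k))     ≡⟨ +suc-block c (toℕ q) (toℕ (opposite k)) ⟩
  + 1 + + toℕ q * + c + + toℕ (opposite k)     ≡⟨ cong (_+_ (+ 1 + + toℕ q * + c)) (+opposite k) ⟩
  + 1 + + toℕ q * + c + (+ c - + suc (toℕ k))  ≡⟨ lemma (+ toℕ q) (+ c) (+ toℕ k) ⟩
  value (down q) (+ c) (+ toℕ k)               ∎
  where
  open ≡-Reasoning
  lemma : ∀ q c k → + 1 + q * c + (c - (+ 1 + k)) ≡ + 0 + (+ 1 + q) * c + - + 1 * k
  lemma = solve-∀
place-value {c = c} (pair L U h) adj k = begin
  + suc (toℕ (combine (pick e L U) r))
    ≡⟨ cong (+_ ∘ suc) (index-pick h adj e r) ⟩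
  + suc (c ℕ.* toℕ L ℕ.+ toℕ (combine e r))
    ≡⟨ cong (λ x → + suc (c ℕ.* toℕ L ℕ.+ x)) (toℕ-interleave k h) ⟩
  + suc (c ℕ.* toℕ L ℕ.+ (2 ℕ.* toℕ k ℕ.+ toℕ h))
    ≡⟨ +suc-block c (toℕ L) _ ⟩
  + 1 + + toℕ L * + c + (+ (2 ℕ.* toℕ k) + + toℕ h)
    ≡⟨ cong (λ x → + 1 + + toℕ L * + c + (x + + toℕ h)) (ℤ.pos-* 2 (toℕ k)) ⟩
  + 1 + + toℕ L * + c + (+ 2 * + toℕ k + + toℕ h)
    ≡⟨ lemma (+ toℕ L) (+ c) (+ toℕ k) (+ toℕ h) ⟩
  value (pair L U h) (+ c) (+ toℕ k) ∎
  where
  open ≡-Reasoning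
  e : Fin 2
  e = proj₁ (interleave k h)
  r : Fin c
  r = proj₂ (interleave k h)
  lemma : ∀ l c k h → + 1 + l * c + (+ 2 * k + h) ≡ + 1 + h + l * c + + 2 * k
  lemma = solve-∀

mapKind : ∀ {m n} → (Fin m → Fin n) → Kind m → Kind n
mapKind f (up q)       = up (f q)
mapKind f (down q)     = down (f q)
mapKind f (pair L U h) = pair (f L) (f U) h

mapCell : ∀ {m n} → (Fin m → Fin n) → Cell m → Cell n
mapCell f x = proj₁ x , mapKind f (proj₂ x)

place-mapKind : ∀ {m n c} (f : Fin m → Fin n) κ (k : Fin c) → place (mapKind f κ) k ≡ map₁ f (place κ k)
place-mapKind f (up q)       k = refl
place-mapKind f (down q)     k = refl
place-mapKind f (pair L U h) k = cong (_, proj₂ (interleave k h)) (pick-map (proj₁ (interleave k h)))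
  where
  pick-map : ∀ e → pick e (f L) (f U) ≡ f (pick e L U)
  pick-map zero    = refl
  pick-map (suc _) = refl

Translation : ∀ {m n} → ℕ → (Fin m → Fin n) → Set
Translation d f = ∀ q → toℕ (f q) ≡ d ℕ.+ toℕ q

translation-↑ˡ : ∀ {m} n → Translation 0 (λ (q : Fin m) → q ↑ˡ n)
translation-↑ˡ n q = Fin.toℕ-↑ˡ q n

translation-↑ʳ : ∀ m {n} → Translation m (λ (q : Fin n) → m ↑ʳ q)
translation-↑ʳ m q = Fin.toℕ-↑ʳ m q

adjacent-mapKind : ∀ {m n d} {f : Fin m → Fin n} → Translation d f → ∀ κ → Adjacent κ → Adjacent (mapKind f κ)
adjacent-mapKind         tr (up q)       _   = _
adjacent-mapKind         tr (down q)     _   = _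
adjacent-mapKind {d = d} {f} tr (pair L U h) adj = begin
  toℕ (f U)              ≡⟨ tr U ⟩
  d ℕ.+ toℕ U            ≡⟨ cong (d ℕ.+_) adj ⟩
  d ℕ.+ suc (toℕ L)      ≡⟨ ℕ.+-suc d (toℕ L) ⟩
  suc (d ℕ.+ toℕ L)      ≡⟨ cong suc (sym (tr L)) ⟩
  suc (toℕ (f L))        ∎
  where open ≡-Reasoning

value-mapKind : ∀ {m n d} {f : Fin m → Fin n} → Translation d f →
                ∀ κ c r → value (mapKind f κ) c r ≡ value κ c r + + d * c
value-mapKind {d = d} {f} tr (up q) c r = begin
  + 1 + + toℕ (f q) * c + + 1 * r           ≡⟨ cong (λ x → + 1 + + x * c + + 1 * r) (tr q) ⟩
  + 1 + (+ d + + toℕ q) * c + + 1 * r       ≡⟨ lemma (+ d) (+ toℕ q) c r ⟩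
  value (up q) c r + + d * c                ∎
  where
  open ≡-Reasoning
  lemma : ∀ d q c r → + 1 + (d + q) * c + + 1 * r ≡ + 1 + q * c + + 1 * r + d * c
  lemma = solve-∀
value-mapKind {d = d} {f} tr (down q) c r = begin
  + 0 + + suc (toℕ (f q)) * c + - + 1 * r       ≡⟨ cong (λ x → + 0 + + suc x * c + - + 1 * r) (tr q) ⟩
  + 0 + (+ 1 + (+ d + + toℕ q)) * c + - + 1 * r ≡⟨ lemma (+ d) (+ toℕ q) c r ⟩
  value (down q) c r + + d * c                  ∎
  where
  open ≡-Reasoning
  lemma : ∀ d q c r → + 0 + (+ 1 + (d + q)) * c + - + 1 * r ≡ + 0 + (+ 1 + q) * c + - + 1 * r + d * c
  lemma = solve-∀
value-mapKind {d = d} {f} tr (pair L U h) c r = begin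
  + suc (toℕ h) + + toℕ (f L) * c + + 2 * r       ≡⟨ cong (λ x → + suc (toℕ h) + + x * c + + 2 * r) (tr L) ⟩
  + suc (toℕ h) + (+ d + + toℕ L) * c + + 2 * r   ≡⟨ lemma (+ suc (toℕ h)) (+ d) (+ toℕ L) c r ⟩
  value (pair L U h) c r + + d * c                ∎
  where
  open ≡-Reasoning
  lemma : ∀ a d l c r → a + (d + l) * c + + 2 * r ≡ a + l * c + + 2 * r + d * c
  lemma = solve-∀

polarity : ∀ {m} → Cell m → ℤ
polarity x = signed (proj₁ x) (+ 1)

Σ-mapCell : ∀ {m n d} {f : Fin m → Fin n} → Translation d f →
            ∀ l (x : Fin l → Cell m) c r →
            Σℤ l (λ j → cellValue (mapCell f (x j)) c r) ≡
            Σℤ l (λ j → cellValue (x j) c r) + + d * c * Σℤ l (polarity ∘ x)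
Σ-mapCell {d = d} {f} tr l x c r = begin
  Σℤ l (λ j → cellValue (mapCell f (x j)) c r)
    ≡⟨ Σℤ-cong l (λ j → trans (cong (signed (proj₁ (x j))) (value-mapKind tr (proj₂ (x j)) c r))
                              (signed-+ (proj₁ (x j)) _ _)) ⟩
  Σℤ l (λ j → cellValue (x j) c r + signed (proj₁ (x j)) (+ d * c))
    ≡⟨ Σℤ-+ l _ _ ⟩
  Σℤ l (λ j → cellValue (x j) c r) + Σℤ l (λ j → signed (proj₁ (x j)) (+ d * c))
    ≡⟨ cong (_+_ (Σℤ l (λ j → cellValue (x j) c r)))
            (trans (Σℤ-cong l (λ j → signed-scale (proj₁ (x j)) (+ d * c)))
                   (Σℤ-*ˡ l (+ d * c) (polarity ∘ x))) ⟩
  Σℤ l (λ j → cellValue (x j) c r) + + d * c * Σℤ l (polarity ∘ x) ∎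
  where open ≡-Reasoning

encode : ∀ {m c} → Cell m → Fin c → Bool × Fin m × Fin c
encode x k = proj₁ x , place (proj₂ x) k

-- A 6 × w pattern of signed blocks whose c copies are signed magic arrays sharing the values
-- ±1, …, ±m c (see FromCore).
record Core (w m : ℕ) : Set where
  field
    cell          : Fin 6 → Fin w → Cell m
    adjacent      : ∀ i j → Adjacent (proj₂ (cell i j))
    decode        : ∀ {c} → Bool × Fin m × Fin c → (Fin 6 × Fin w) × Fin c
    decode-encode : ∀ {c} i j (k : Fin c) → decode (encode (cell i j) k) ≡ ((i , j) , k)
    row-sums      : ∀ i c r → Σℤ w (λ j → cellValue (cell i j) c r) ≡ + 0
    col-sums      : ∀ j c r → Σℤ 6 (λ i → cellValue (cell i j) c r) ≡ + 0

Balanced : ∀ {w m} → Core w m → Set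
Balanced {w} K = (∀ i → Σℤ w (λ j → polarity (cell i j)) ≡ + 0)
               × (∀ j → Σℤ 6 (λ i → polarity (cell i j)) ≡ + 0)
  where open Core K

empty : Core 0 0
empty = record
  { cell          = λ _ ()
  ; adjacent      = λ _ ()
  ; decode        = λ { (_ , () , _) }
  ; decode-encode = λ _ ()
  ; row-sums      = λ _ _ _ → refl
  ; col-sums      = λ ()
  }

empty-balanced : Balanced empty
empty-balanced = (λ _ → refl) , (λ ())

-- K′ is placed to the right of K with its blocks shifted past those of K; the shift adds m c
-- times the signed cell count to each line sum of K′, hence the balance condition.
module Concatenation {a b m n} (K : Core a m) (K′ : Core b n) (K′-balanced : Balanced K′) where
  private
    module K  = Core K
    module K′ = Core K′

  cellˢ : Fin 6 → Fin a ⊎ Fin b → Cell (m ℕ.+ n)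
  cellˢ i (inj₁ j) = mapCell (_↑ˡ n) (K.cell i j)
  cellˢ i (inj₂ j) = mapCell (m ↑ʳ_) (K′.cell i j)

  decodeˢ : ∀ {c} → Bool → Fin m ⊎ Fin n → Fin c → (Fin 6 × Fin (a ℕ.+ b)) × Fin c
  decodeˢ σ (inj₁ q) r = map₁ (map₂ (_↑ˡ b)) (K.decode (σ , q , r))
  decodeˢ σ (inj₂ q) r = map₁ (map₂ (a ↑ʳ_)) (K′.decode (σ , q , r))

  cell : Fin 6 → Fin (a ℕ.+ b) → Cell (m ℕ.+ n)
  cell i j = cellˢ i (splitAt a j)

  decode : ∀ {c} → Bool × Fin (m ℕ.+ n) × Fin c → (Fin 6 × Fin (a ℕ.+ b)) × Fin c
  decode (σ , q , r) = decodeˢ σ (splitAt m q) r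

  adjacent : ∀ i j → Adjacent (proj₂ (cell i j))
  adjacent i j with splitAt a j
  ... | inj₁ j₁ = adjacent-mapKind (translation-↑ˡ n) _ (K.adjacent i j₁)
  ... | inj₂ j₂ = adjacent-mapKind (translation-↑ʳ m) _ (K′.adjacent i j₂)

  decode-encodeˢ : ∀ {c} i s (k : Fin c) → decode (encode (cellˢ i s) k) ≡ ((i , join a b s) , k)
  decode-encodeˢ i (inj₁ j) k = begin
    decode (encode (mapCell (_↑ˡ n) (K.cell i j)) k)
      ≡⟨ cong (λ p → decodeˢ σ (splitAt m (proj₁ p)) (proj₂ p)) (place-mapKind (_↑ˡ n) κ k) ⟩
    decodeˢ σ (splitAt m (proj₁ (place κ k) ↑ˡ n)) (proj₂ (place κ k))
      ≡⟨ cong (λ s → decodeˢ σ s (proj₂ (place κ k))) (Fin.splitAt-↑ˡ m _ n) ⟩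
    map₁ (map₂ (_↑ˡ b)) (K.decode (encode (K.cell i j) k))
      ≡⟨ cong (map₁ (map₂ (_↑ˡ b))) (K.decode-encode i j k) ⟩
    ((i , j ↑ˡ b) , k) ∎
    where
    open ≡-Reasoning
    σ : Bool
    σ = proj₁ (K.cell i j)
    κ : Kind m
    κ = proj₂ (K.cell i j)
  decode-encodeˢ i (inj₂ j) k = begin
    decode (encode (mapCell (m ↑ʳ_) (K′.cell i j)) k)
      ≡⟨ cong (λ p → decodeˢ σ (splitAt m (proj₁ p)) (proj₂ p)) (place-mapKind (m ↑ʳ_) κ k) ⟩
    decodeˢ σ (splitAt m (m ↑ʳ proj₁ (place κ k))) (proj₂ (place κ k))
      ≡⟨ cong (λ s → decodeˢ σ s (proj₂ (place κ k))) (Fin.splitAt-↑ʳ m n _) ⟩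
    map₁ (map₂ (a ↑ʳ_)) (K′.decode (encode (K′.cell i j) k))
      ≡⟨ cong (map₁ (map₂ (a ↑ʳ_))) (K′.decode-encode i j k) ⟩
    ((i , a ↑ʳ j) , k) ∎
    where
    open ≡-Reasoning
    σ : Bool
    σ = proj₁ (K′.cell i j)
    κ : Kind n
    κ = proj₂ (K′.cell i j)

  decode-encode : ∀ {c} i j (k : Fin c) → decode (encode (cell i j) k) ≡ ((i , j) , k)
  decode-encode i j k =
    trans (decode-encodeˢ i (splitAt a j) k) (cong (λ j′ → (i , j′) , k) (Fin.join-splitAt a b j))

  private
    Σ-left : ∀ l (x : Fin l → Cell m) c r → Σℤ l (λ j → cellValue (x j) c r) ≡ + 0 →
             Σℤ l (λ j → cellValue (mapCell (_↑ˡ n) (x j)) c r) ≡ + 0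
    Σ-left l x c r sum≡0 = begin
      Σℤ l (λ j → cellValue (mapCell (_↑ˡ n) (x j)) c r)     ≡⟨ Σ-mapCell (translation-↑ˡ n) l x c r ⟩
      Σℤ l (λ j → cellValue (x j) c r) + + 0 * c * Σℤ l (polarity ∘ x)
        ≡⟨ cong₂ _+_ sum≡0 (trans (cong (_* count) (ℤ.*-zeroˡ c)) (ℤ.*-zeroˡ count)) ⟩
      + 0                                                    ∎
      where
      open ≡-Reasoning
      count : ℤ
      count = Σℤ l (polarity ∘ x)

    Σ-right : ∀ l (x : Fin l → Cell n) c r → Σℤ l (λ j → cellValue (x j) c r) ≡ + 0 →
              Σℤ l (polarity ∘ x) ≡ + 0 → Σℤ l (λ j → cellValue (mapCell (m ↑ʳ_) (x j)) c r) ≡ + 0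
    Σ-right l x c r sum≡0 count≡0 = begin
      Σℤ l (λ j → cellValue (mapCell (m ↑ʳ_) (x j)) c r)     ≡⟨ Σ-mapCell (translation-↑ʳ m) l x c r ⟩
      Σℤ l (λ j → cellValue (x j) c r) + + m * c * Σℤ l (polarity ∘ x)
        ≡⟨ cong₂ _+_ sum≡0 (trans (cong (+ m * c *_) count≡0) (ℤ.*-zeroʳ (+ m * c))) ⟩
      + 0                                                    ∎
      where open ≡-Reasoning

  row-sums : ∀ i c r → Σℤ (a ℕ.+ b) (λ j → cellValue (cell i j) c r) ≡ + 0
  row-sums i c r = trans (Σℤ-splitAt a b (λ s → cellValue (cellˢ i s) c r))
    (cong₂ _+_ (Σ-left a (K.cell i) c r (K.row-sums i c r))
               (Σ-right b (K′.cell i) c r (K′.row-sums i c r) (proj₁ K′-balanced i)))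

  col-sums : ∀ j c r → Σℤ 6 (λ i → cellValue (cell i j) c r) ≡ + 0
  col-sums j c r with splitAt a j
  ... | inj₁ j₁ = Σ-left 6 (λ i → K.cell i j₁) c r (K.col-sums j₁ c r)
  ... | inj₂ j₂ = Σ-right 6 (λ i → K′.cell i j₂) c r (K′.col-sums j₂ c r) (proj₂ K′-balanced j₂)

  core : Core (a ℕ.+ b) (m ℕ.+ n)
  core = record
    { cell = cell ; adjacent = adjacent ; decode = decode ; decode-encode = decode-encode
    ; row-sums = row-sums ; col-sums = col-sums }

  balanced : Balanced K → Balanced core
  balanced (K-rows , K-cols) = rows , cols
    where
    rows : ∀ i → Σℤ (a ℕ.+ b) (λ j → polarity (cell i j)) ≡ + 0
    rows i = trans (Σℤ-splitAt a b (λ s → polarity (cellˢ i s)))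
                   (cong₂ _+_ (K-rows i) (proj₁ K′-balanced i))
    cols : ∀ j → Σℤ 6 (λ i → polarity (cell i j)) ≡ + 0
    cols j with splitAt a j
    ... | inj₁ j₁ = K-cols j₁
    ... | inj₂ j₂ = proj₂ K′-balanced j₂

replicate : ∀ {b n} u (K : Core b n) → Balanced K → Σ (Core (u ℕ.* b) (u ℕ.* n)) Balanced
replicate ℕ.zero  K K-balanced = empty , empty-balanced
replicate (suc u) K K-balanced =
  let K′ , K′-balanced = replicate u K K-balanced
      open Concatenation K K′ K′-balanced
  in core , balanced K-balanced

module FromCore {w m} (K : Core w m) (m≡3w : m ≡ 3 ℕ.* w) (c : ℕ) where
  open Core K

  position : (Fin 6 × Fin w) × Fin c → Bool × Fin m × Fin c
  position ((i , j) , k) = encode (cell i j) k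

  position-injective : Injective _≡_ _≡_ position
  position-injective {(i , j) , k} {(i′ , j′) , k′} eq =
    trans (sym (decode-encode i j k)) (trans (cong decode eq) (decode-encode i′ j′ k′))

  N : ℕ
  N = 6 ℕ.* w ℕ.* c

  N≡2mc : N ≡ m ℕ.* c ℕ.* 2
  N≡2mc = trans (lemma w c) (cong (λ m → m ℕ.* c ℕ.* 2) (sym m≡3w))
    where
    lemma : ∀ w c → 6 ℕ.* w ℕ.* c ≡ 3 ℕ.* w ℕ.* c ℕ.* 2
    lemma = NatSolver.solve-∀

  -- The cells of the arrays and the elements of Ω both number N = 2 m c, so the injection
  -- position is onto.
  position-surjective : ∀ y → ∃ λ x → position x ≡ y
  position-surjective = ↔-injective⇒surjective cells↔ slots↔ position position-injective
    where
    cells↔ : ((Fin 6 × Fin w) × Fin c) ↔ Fin N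
    cells↔ = ↔-trans (↔-sym Fin.*↔× ×-↔ ↔-refl) (↔-sym Fin.*↔×)
    slots↔ : (Bool × Fin m × Fin c) ↔ Fin N
    slots↔ = subst (λ n → (Bool × Fin m × Fin c) ↔ Fin n) (trans (ℕ.*-comm 2 (m ℕ.* c)) (sym N≡2mc))
                   (↔-trans (↔-sym Fin.2↔Bool ×-↔ ↔-sym Fin.*↔×) (↔-sym Fin.*↔×))

  N-even : N % 2 ≡ 0
  N-even = trans (cong (_% 2) N≡2mc) (m*n%n≡0 (m ℕ.* c) 2)

  N/2≡mc : N / 2 ≡ m ℕ.* c
  N/2≡mc = trans (cong (_/ 2) N≡2mc) (m*n/n≡m (m ℕ.* c) 2)

  arrays : Arrays 6 w c
  arrays k i j = entry (position ((i , j) , k))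

  arrays-cellValue : ∀ k i j → arrays k i j ≡ cellValue (cell i j) (+ c) (+ toℕ k)
  arrays-cellValue k i j = cong (signed (proj₁ (cell i j))) (place-value (proj₂ (cell i j)) (adjacent i j) k)

  isSMAS : IsSMAS 6 w c arrays
  isSMAS = record
    { entries-in-Ω     = λ k i j → let y = position ((i , j) , k) in
                           InΩ-intro N (entry y) (entry-nonzero y) (subst (∣ entry y ∣ ≤_) (sym N/2≡mc) (∣entry∣≤ y))
    ; entries-distinct = distinct
    ; Ω-covered        = covered
    ; row-sums         = λ k i → trans (Σℤ-cong w (arrays-cellValue k i)) (row-sums i _ _)
    ; col-sums         = λ k j → trans (Σℤ-cong 6 (λ i → arrays-cellValue k i j)) (col-sums j _ _)
    }
    where
    distinct : ∀ k i j k′ i′ j′ → arrays k i j ≡ arrays k′ i′ j′ → (k ≡ k′) × (i ≡ i′) × (j ≡ j′)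
    distinct k i j k′ i′ j′ eq with refl ← position-injective (entry-injective eq) = refl , refl , refl
    covered : ∀ ω → InΩ N ω → ∃ λ k → ∃ λ i → ∃ λ j → arrays k i j ≡ ω
    covered ω ω∈Ω =
      let ω≢0 , ∣ω∣≤N/2       = InΩ-even-elim N ω N-even ω∈Ω
          y , entry-y≡ω        = entry-onto ω ω≢0 (subst (∣ ω ∣ ≤_) N/2≡mc ∣ω∣≤N/2)
          ((i , j) , k) , py≡y = position-surjective y
      in k , i , j , trans (cong entry py≡y) entry-y≡ω

  smas : SMAS 6 w c
  smas = arrays , isSMAS

-- Where the block of a given sign and number goes: into one cell, in increasing or decreasing
-- order over the arrays, or as block e of a pair shared by the cells of half 0 and half 1.
data Owner (w : ℕ) : Set where
  up down : Fin 6 × Fin w → Owner w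
  halves  : Fin 2 → Fin 6 × Fin w → Fin 6 × Fin w → Owner w

decodeOwner : ∀ {w c} → Owner w → Fin c → (Fin 6 × Fin w) × Fin c
decodeOwner (up p)           r = p , r
decodeOwner (down p)         r = p , opposite r
decodeOwner (halves e p₀ p₁) r = pick (proj₂ (deinterleave e r)) p₀ p₁ , proj₁ (deinterleave e r)

half : ∀ {w} → Owner w → Fin 2 → Fin 6 × Fin w
half (up p)           _ = p
half (down p)         _ = p
half (halves _ p₀ p₁) h = pick h p₀ p₁

pick-half : ∀ {w} (o : Owner w) h → pick h (half o zero) (half o (suc zero)) ≡ half o h
pick-half o zero       = refl
pick-half o (suc zero) = refl

Recovers : ∀ {w m} → (Bool → Fin m → Owner w) → Fin 6 × Fin w → Cell m → Set
Recovers owner p (σ , up q)       = owner σ q ≡ up p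
Recovers owner p (σ , down q)     = owner σ q ≡ down p
Recovers owner p (σ , pair L U h) =
  owner σ L ≡ halves zero (half (owner σ L) zero) (half (owner σ L) (suc zero)) ×
  owner σ U ≡ halves (suc zero) (half (owner σ L) zero) (half (owner σ L) (suc zero)) ×
  half (owner σ L) h ≡ p

decodeTable : ∀ {w m c} → (Bool → Fin m → Owner w) → Bool × Fin m × Fin c → (Fin 6 × Fin w) × Fin c
decodeTable owner (σ , q , r) = decodeOwner (owner σ q) r

decodeTable-encode : ∀ {w m} (owner : Bool → Fin m → Owner w) p x → Recovers owner p x →
                     ∀ {c} (k : Fin c) → decodeTable owner (encode x k) ≡ (p , k)
decodeTable-encode owner p (σ , up q)   eq k = cong (λ o → decodeOwner o k) eq
decodeTable-encode owner p (σ , down q) eq k =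
  trans (cong (λ o → decodeOwner o (opposite k)) eq) (cong (p ,_) (Fin.opposite-involutive k))
decodeTable-encode owner p (σ , pair L U h) (eqL , eqU , eqp) k = begin
  decodeOwner (owner σ (pick e L U)) r                      ≡⟨ cong (λ o → decodeOwner o r) (owner-pick e) ⟩
  pick (proj₂ (deinterleave e r)) p₀ p₁ , proj₁ (deinterleave e r)
    ≡⟨ cong (λ d → pick (proj₂ d) p₀ p₁ , proj₁ d) (deinterleave-interleave k h) ⟩
  pick h p₀ p₁ , k                                          ≡⟨ cong (_, k) (trans (pick-half o h) eqp) ⟩
  p , k                                                     ∎
  where
  open ≡-Reasoning
  o : Owner _
  o = owner σ L
  p₀ p₁ : Fin 6 × Fin _
  p₀ = half o zero
  p₁ = half o (suc zero)
  e : Fin 2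
  e = proj₁ (interleave k h)
  r : Fin _
  r = proj₂ (interleave k h)
  owner-pick : ∀ e → owner σ (pick e L U) ≡ halves e p₀ p₁
  owner-pick zero       = eqL
  owner-pick (suc zero) = eqU

_≟ᵖ_ : ∀ {w} → DecidableEquality (Fin 6 × Fin w)
_≟ᵖ_ = ≡-dec Fin._≟_ Fin._≟_

_≟ᴼ_ : ∀ {w} → DecidableEquality (Owner w)
up p   ≟ᴼ up p′   = map′ (cong up) (λ { refl → refl }) (p ≟ᵖ p′)
down p ≟ᴼ down p′ = map′ (cong down) (λ { refl → refl }) (p ≟ᵖ p′)
halves e p₀ p₁ ≟ᴼ halves e′ p₀′ p₁′ =
  map′ (λ { (refl , refl , refl) → refl }) (λ { refl → refl , refl , refl })
       (e Fin.≟ e′ ×-dec p₀ ≟ᵖ p₀′ ×-dec p₁ ≟ᵖ p₁′)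
up _       ≟ᴼ down _       = no λ ()
up _       ≟ᴼ halves _ _ _ = no λ ()
down _     ≟ᴼ up _         = no λ ()
down _     ≟ᴼ halves _ _ _ = no λ ()
halves _ _ _ ≟ᴼ up _       = no λ ()
halves _ _ _ ≟ᴼ down _     = no λ ()

recovers? : ∀ {w m} owner (p : Fin 6 × Fin w) (x : Cell m) → Dec (Recovers owner p x)
recovers? owner p (σ , up q)       = owner σ q ≟ᴼ up p
recovers? owner p (σ , down q)     = owner σ q ≟ᴼ down p
recovers? owner p (σ , pair L U h) = (owner σ L ≟ᴼ _) ×-dec (owner σ U ≟ᴼ _) ×-dec (half (owner σ L) h ≟ᵖ p)

adjacent? : ∀ {m} (κ : Kind m) → Dec (Adjacent κ)
adjacent? (up _)       = yes _
adjacent? (down _)     = yes _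
adjacent? (pair L U _) = toℕ U ℕ.≟ suc (toℕ L)

affine : ∀ {m} → Cell m → Affine
affine (σ , κ) = signedᵃ σ (coefficients κ)

cellValue-affine : ∀ {m} (x : Cell m) c r → cellValue x c r ≡ ⟦ affine x ⟧ c r
cellValue-affine (σ , κ) c r = sym (⟦signedᵃ⟧ σ (coefficients κ) c r)

_≟ᵃ_ : DecidableEquality Affine
_≟ᵃ_ = ≡-dec ℤ._≟_ (≡-dec ℤ._≟_ ℤ._≟_)

Σ-cellValue : ∀ {m} l (x : Fin l → Cell m) → Σᵃ l (affine ∘ x) ≡ 0ᵃ →
              ∀ c r → Σℤ l (λ j → cellValue (x j) c r) ≡ + 0
Σ-cellValue l x coeffs≡0 c r = begin
  Σℤ l (λ j → cellValue (x j) c r)     ≡⟨ Σℤ-cong l (λ j → cellValue-affine (x j) c r) ⟩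
  Σℤ l (λ j → ⟦ affine (x j) ⟧ c r)    ≡⟨ sym (⟦Σᵃ⟧ l (affine ∘ x) c r) ⟩
  ⟦ Σᵃ l (affine ∘ x) ⟧ c r            ≡⟨ cong (λ a → ⟦ a ⟧ c r) coeffs≡0 ⟩
  ⟦ 0ᵃ ⟧ c r                           ≡⟨ ⟦0ᵃ⟧ c r ⟩
  + 0                                  ∎
  where open ≡-Reasoning

module Tabulated {w m} (cell : Fin 6 → Fin w → Cell m) (owner : Bool → Fin m → Owner w) where

  WellFormed : Set
  WellFormed = (∀ i j → Adjacent (proj₂ (cell i j)) × Recovers owner (i , j) (cell i j))
             × (∀ i → Σᵃ w (λ j → affine (cell i j)) ≡ 0ᵃ)
             × (∀ j → Σᵃ 6 (λ i → affine (cell i j)) ≡ 0ᵃ)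

  wellFormed? : Dec WellFormed
  wellFormed? = Fin.all? (λ i → Fin.all? (λ j → adjacent? (proj₂ (cell i j)) ×-dec recovers? owner (i , j) (cell i j)))
         ×-dec Fin.all? (λ i → Σᵃ w (λ j → affine (cell i j)) ≟ᵃ 0ᵃ)
         ×-dec Fin.all? (λ j → Σᵃ 6 (λ i → affine (cell i j)) ≟ᵃ 0ᵃ)

  core : WellFormed → Core w m
  core (local , rows , cols) = record
    { cell          = cell
    ; adjacent      = λ i j → proj₁ (local i j)
    ; decode        = decodeTable owner
    ; decode-encode = λ i j → decodeTable-encode owner (i , j) (cell i j) (proj₂ (local i j))
    ; row-sums      = λ i → Σ-cellValue w (cell i) (rows i)
    ; col-sums      = λ j → Σ-cellValue 6 (λ i → cell i j) (cols j)
    }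

balanced? : ∀ {w m} (K : Core w m) → Dec (Balanced K)
balanced? {w} K = Fin.all? (λ i → Σℤ w (λ j → polarity (cell i j)) ℤ.≟ + 0)
            ×-dec Fin.all? (λ j → Σℤ 6 (λ i → polarity (cell i j)) ℤ.≟ + 0)
  where open Core K

core₅ : Core 5 15
core₅ = Tabulated.core cell owner (from-yes (Tabulated.wellFormed? cell owner))
  where
  cells : Vec (Vec (Cell 15) 5) 6
  cells =
    (⁺ pair (# 0) (# 1) (# 0) ∷ ⁺ down (# 11)            ∷ ⁻ up (# 12)   ∷ ⁺ up (# 14)   ∷ ⁻ up (# 14)              ∷ []) ∷
    (⁻ pair (# 0) (# 1) (# 0) ∷ ⁺ up (# 9)               ∷ ⁻ down (# 8)  ∷ ⁻ down (# 10) ∷ ⁺ down (# 10)            ∷ []) ∷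
    (⁺ pair (# 2) (# 3) (# 0) ∷ ⁻ pair (# 0) (# 1) (# 1) ∷ ⁺ down (# 8)  ∷ ⁻ up (# 11)   ∷ ⁺ pair (# 0) (# 1) (# 1) ∷ []) ∷
    (⁻ pair (# 2) (# 3) (# 0) ∷ ⁻ up (# 9)               ∷ ⁻ down (# 7)  ∷ ⁺ up (# 7)    ∷ ⁺ up (# 12)              ∷ []) ∷
    (⁻ up (# 4)               ∷ ⁺ pair (# 2) (# 3) (# 1) ∷ ⁺ down (# 13) ∷ ⁻ up (# 5)    ∷ ⁻ down (# 6)             ∷ []) ∷
    (⁺ up (# 4)               ∷ ⁻ down (# 13)            ∷ ⁺ up (# 6)    ∷ ⁺ down (# 5)  ∷ ⁻ pair (# 2) (# 3) (# 1) ∷ []) ∷ []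
  positive negative : Vec (Owner 5) 15
  positive =
      halves (# 0) (# 0 , # 0) (# 2 , # 4) ∷ halves (# 1) (# 0 , # 0) (# 2 , # 4) ∷ halves (# 0) (# 2 , # 0) (# 4 , # 1)
    ∷ halves (# 1) (# 2 , # 0) (# 4 , # 1) ∷ up (# 5 , # 0)                       ∷ down (# 5 , # 3)
    ∷ up (# 5 , # 2)                       ∷ up (# 3 , # 3)                       ∷ down (# 2 , # 2)
    ∷ up (# 1 , # 1)                       ∷ down (# 1 , # 4)                     ∷ down (# 0 , # 1)
    ∷ up (# 3 , # 4)                       ∷ down (# 4 , # 2)                     ∷ up (# 0 , # 3) ∷ []
  negative =
      halves (# 0) (# 1 , # 0) (# 2 , # 1) ∷ halves (# 1) (# 1 , # 0) (# 2 , # 1) ∷ halves (# 0) (# 3 , # 0) (# 5 , # 4)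
    ∷ halves (# 1) (# 3 , # 0) (# 5 , # 4) ∷ up (# 4 , # 0)                       ∷ up (# 4 , # 3)
    ∷ down (# 4 , # 4)                     ∷ down (# 3 , # 2)                     ∷ down (# 1 , # 2)
    ∷ up (# 3 , # 1)                       ∷ down (# 1 , # 3)                     ∷ up (# 2 , # 3)
    ∷ up (# 0 , # 2)                       ∷ down (# 5 , # 1)                     ∷ up (# 0 , # 4) ∷ []
  cell : Fin 6 → Fin 5 → Cell 15
  cell i j = lookup (lookup cells i) j
  owner : Bool → Fin 15 → Owner 5
  owner true  = lookup positive
  owner false = lookup negative

core₇ : Core 7 21
core₇ = Tabulated.core cell owner (from-yes (Tabulated.wellFormed? cell owner))
  where
  cells : Vec (Vec (Cell 21) 7) 6
  cells =
    (⁺ pair (# 0) (# 1) (# 0) ∷ ⁺ up (# 10)              ∷ ⁻ up (# 11)   ∷ ⁺ down (# 12)            ∷ ⁻ up (# 12)              ∷ ⁺ up (# 14) ∷ ⁻ up (# 14) ∷ []) ∷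
    (⁻ pair (# 0) (# 1) (# 0) ∷ ⁻ up (# 10)              ∷ ⁺ up (# 13)   ∷ ⁻ down (# 9)             ∷ ⁺ up (# 7)               ∷ ⁺ up (# 18) ∷ ⁻ up (# 18) ∷ []) ∷
    (⁻ up (# 4)               ∷ ⁻ down (# 5)             ∷ ⁺ down (# 15) ∷ ⁺ pair (# 0) (# 1) (# 1) ∷ ⁻ up (# 6)               ∷ ⁺ up (# 20) ∷ ⁻ up (# 20) ∷ []) ∷
    (⁺ up (# 9)               ∷ ⁻ pair (# 2) (# 3) (# 0) ∷ ⁻ down (# 8)  ∷ ⁻ pair (# 0) (# 1) (# 1) ∷ ⁺ pair (# 2) (# 3) (# 1) ∷ ⁻ up (# 16) ∷ ⁺ up (# 16) ∷ []) ∷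
    (⁺ down (# 8)             ∷ ⁺ pair (# 2) (# 3) (# 0) ∷ ⁻ up (# 15)   ∷ ⁻ up (# 7)               ∷ ⁺ up (# 11)              ∷ ⁻ up (# 17) ∷ ⁺ up (# 17) ∷ []) ∷
    (⁻ down (# 13)            ∷ ⁺ down (# 5)             ∷ ⁺ up (# 6)    ∷ ⁺ up (# 4)               ∷ ⁻ pair (# 2) (# 3) (# 1) ∷ ⁻ up (# 19) ∷ ⁺ up (# 19) ∷ []) ∷ []
  positive negative : Vec (Owner 7) 21
  positive =
      halves (# 0) (# 0 , # 0) (# 2 , # 3) ∷ halves (# 1) (# 0 , # 0) (# 2 , # 3) ∷ halves (# 0) (# 4 , # 1) (# 3 , # 4)
    ∷ halves (# 1) (# 4 , # 1) (# 3 , # 4) ∷ up (# 5 , # 3)                       ∷ down (# 5 , # 1)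
    ∷ up (# 5 , # 2)                       ∷ up (# 1 , # 4)                       ∷ down (# 4 , # 0)
    ∷ up (# 3 , # 0)                       ∷ up (# 0 , # 1)                       ∷ up (# 4 , # 4)
    ∷ down (# 0 , # 3)                     ∷ up (# 1 , # 2)                       ∷ up (# 0 , # 5)
    ∷ down (# 2 , # 2)                     ∷ up (# 3 , # 6)                       ∷ up (# 4 , # 6)
    ∷ up (# 1 , # 5)                       ∷ up (# 5 , # 6)                       ∷ up (# 2 , # 5) ∷ []
  negative =
      halves (# 0) (# 1 , # 0) (# 3 , # 3) ∷ halves (# 1) (# 1 , # 0) (# 3 , # 3) ∷ halves (# 0) (# 3 , # 1) (# 5 , # 4)
    ∷ halves (# 1) (# 3 , # 1) (# 5 , # 4) ∷ up (# 2 , # 0)                       ∷ down (# 2 , # 1)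
    ∷ up (# 2 , # 4)                       ∷ up (# 4 , # 3)                       ∷ down (# 3 , # 2)
    ∷ down (# 1 , # 3)                     ∷ up (# 1 , # 1)                       ∷ up (# 0 , # 2)
    ∷ up (# 0 , # 4)                       ∷ down (# 5 , # 0)                     ∷ up (# 0 , # 6)
    ∷ up (# 4 , # 2)                       ∷ up (# 3 , # 5)                       ∷ up (# 4 , # 5)
    ∷ up (# 1 , # 6)                       ∷ up (# 5 , # 5)                       ∷ up (# 2 , # 6) ∷ []
  cell : Fin 6 → Fin 7 → Cell 21
  cell i j = lookup (lookup cells i) j
  owner : Bool → Fin 21 → Owner 7
  owner true  = lookup positive
  owner false = lookup negative

core₄ : Core 4 12
core₄ = Tabulated.core cell owner (from-yes (Tabulated.wellFormed? cell owner))
  where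
  cells : Vec (Vec (Cell 12) 4) 6
  cells =
    (⁺ up (# 0) ∷ ⁻ up (# 0) ∷ ⁺ up (# 5)  ∷ ⁻ up (# 5)  ∷ []) ∷
    (⁺ up (# 2) ∷ ⁻ up (# 2) ∷ ⁺ up (# 9)  ∷ ⁻ up (# 9)  ∷ []) ∷
    (⁺ up (# 6) ∷ ⁻ up (# 6) ∷ ⁺ up (# 11) ∷ ⁻ up (# 11) ∷ []) ∷
    (⁻ up (# 1) ∷ ⁺ up (# 1) ∷ ⁻ up (# 7)  ∷ ⁺ up (# 7)  ∷ []) ∷
    (⁻ up (# 3) ∷ ⁺ up (# 3) ∷ ⁻ up (# 8)  ∷ ⁺ up (# 8)  ∷ []) ∷
    (⁻ up (# 4) ∷ ⁺ up (# 4) ∷ ⁻ up (# 10) ∷ ⁺ up (# 10) ∷ []) ∷ []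
  positive negative : Vec (Owner 4) 12
  positive =
    up (# 0 , # 0) ∷ up (# 3 , # 1) ∷ up (# 1 , # 0) ∷ up (# 4 , # 1) ∷ up (# 5 , # 1) ∷ up (# 0 , # 2)
    ∷ up (# 2 , # 0) ∷ up (# 3 , # 3) ∷ up (# 4 , # 3) ∷ up (# 1 , # 2) ∷ up (# 5 , # 3) ∷ up (# 2 , # 2) ∷ []
  negative =
    up (# 0 , # 1) ∷ up (# 3 , # 0) ∷ up (# 1 , # 1) ∷ up (# 4 , # 0) ∷ up (# 5 , # 0) ∷ up (# 0 , # 3)
    ∷ up (# 2 , # 1) ∷ up (# 3 , # 2) ∷ up (# 4 , # 2) ∷ up (# 1 , # 3) ∷ up (# 5 , # 2) ∷ up (# 2 , # 3) ∷ []
  cell : Fin 6 → Fin 4 → Cell 12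
  cell i j = lookup (lookup cells i) j
  owner : Bool → Fin 12 → Owner 4
  owner true  = lookup positive
  owner false = lookup negative

core₄-balanced : Balanced core₄
core₄-balanced = from-yes (balanced? core₄)

widen : ∀ {w} → Core w (3 ℕ.* w) → ∀ u c → SMAS 6 (w ℕ.+ u ℕ.* 4) c
widen {w} K u c = FromCore.smas (Concatenation.core K tiles tiles-balanced) (size w u) c
  where
  tiles : Core (u ℕ.* 4) (u ℕ.* 12)
  tiles = proj₁ (replicate u core₄ core₄-balanced)
  tiles-balanced : Balanced tiles
  tiles-balanced = proj₂ (replicate u core₄ core₄-balanced)
  size : ∀ w u → 3 ℕ.* w ℕ.+ u ℕ.* 12 ≡ 3 ℕ.* (w ℕ.+ u ℕ.* 4)
  size = NatSolver.solve-∀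

odd-width : ∀ d → (5 ℕ.+ d) % 2 ≡ 1 → ∃ λ u → 5 ℕ.+ d ≡ 5 ℕ.+ u ℕ.* 4 ⊎ 5 ℕ.+ d ≡ 7 ℕ.+ u ℕ.* 4
odd-width 0 _ = 0 , inj₁ refl
odd-width 2 _ = 0 , inj₂ refl
odd-width (suc (suc (suc (suc d)))) odd with odd-width d odd
... | u , inj₁ eq = suc u , inj₁ (cong (4 ℕ.+_) eq)
... | u , inj₂ eq = suc u , inj₂ (cong (4 ℕ.+_) eq)

-- The construction also works for c = 0.
proposition1p7 : (b : ℕ) → b % 2 ≡ 1 → 5 ≤ b →
                 (c : ℕ) → 1 ≤ c → SMAS 6 b c
proposition1p7 b odd (s≤s (s≤s (s≤s (s≤s (s≤s {n = d} _))))) c _ with odd-width d odd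
... | u , inj₁ b≡5+4u = subst (λ b → SMAS 6 b c) (sym b≡5+4u) (widen core₅ u c)
... | u , inj₂ b≡7+4u = subst (λ b → SMAS 6 b c) (sym b≡7+4u) (widen core₇ u c)
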